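{- Let $k\ge1$. Every $K\in\mathcal{GLI}_k$ has real guards.
   Context: An incidence graph $I=(R(I),B(I),E(I))$ has disjoint finite sets of red and blue nodes and $E(I)\subseteq B(I)\times R(I)$, each red node adjacent to some blue node. A $k$-labeled incidence graph $K=(I,r,b,g)$: incidence graph $I$ with partial maps $r:\mathbb{N}_{\ge1}\rightharpoonup R(I)$, $b:[k]\rightharpoonup B(I)$, $g:\mathbb{N}_{\ge1}\rightharpoonup[k]$, $\mathrm{dom}(g)=\mathrm{dom}(r)$ finite. $K$ has real guards if for all $i\in\mathrm{dom}(r)$: $g(i)\in\mathrm{dom}(b)$ and $(b(g(i)),r(i))\in E(I)$. Partial function notation: $g-S$ restriction to $\mathrm{dom} g\setminus S$; $g_1\cup g_2$ takes $g_1$'s values on $\mathrm{dom} g_1$ and $g_2$'s elsewhere; $g_1,g_2$ compatible if they agree on common domain. Operations: removing red labels $X$: $(I,r-X,b,g-X)$; removing blue labels $X$: $(I,r,b-X,g)$. $K_f$ for partial $f$ with finite nonempty domain: red nodes $v_i$ ($i\in\mathrm{dom} f$), blue nodes $e_j$ ($j\in\mathrm{im} f$), edges $(e_{f(i)},v_i)$, $r(i)=v_i$, $b(j)=e_j$, guard function $f$. Glueing $K_1\oplus K_2$: disjoint union, then identify (via generated equivalence) red nodes carrying the same red label in both and blue nodes carrying the same blue label in both, edges inherited, labels inherited, guard function $g_1\cup g_2$. A transition for $g$ is a partial $f:\mathbb{N}_{\ge1}\rightharpoonup[k]$ with $\emptyset\ne\mathrm{dom} f\subseteq\mathrm{dom}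 g$ such that $i\in\mathrm{dom} f$ whenever $i\in\mathrm{dom} g$ and $g(i)\in\mathrm{im} f$; $K[f]:=K_f\oplus(I,r,b-X,g)$ with $X=\mathrm{im} g\cap\mathrm{im} f\cap\mathrm{dom} b$. The class $\mathcal{GLI}_k$ is the smallest class containing every $K=(I,r,b,g)$ with $R(I)=\mathrm{im}(r)$, $B(I)=\mathrm{im}(b)$ and real guards, and closed under: removing red labels $X\subseteq\mathrm{dom}(r)$; removing blue labels $X\subseteq\mathrm{dom}(b)\setminus\mathrm{im}(g)$; applying a transition $f$ for $g$; glueing $K\oplus K'$ for $K,K'\in\mathcal{GLI}_k$ with compatible guard functions. -}

module Defs where

open import Data.Nat using (ℕ; zero; suc; _≤_)
open import Data.Fin using (Fin)
open import Data.Bool using (Bool; true; false; if_then_else_)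
open import Data.Maybe using (Maybe; just; nothing; is-just; _<∣>_)
import Data.Maybe as Maybe
open import Data.List using (List)
open import Data.List.Membership.Propositional using (_∈_)
open import Data.Product using (Σ; ∃; _×_; _,_; proj₁; proj₂)
open import Data.Sum using (_⊎_; inj₁; inj₂)
open import Function using (_∘_)
open import Function.Bundles using (_⇔_)
open import Relation.Binary.PropositionalEquality using (_≡_; _≢_; refl)
open import Relation.Binary.Construct.Closure.Equivalence using (EqClosure)

-- Conventions.
--  * Red labels live in ℕ; the paper's label set is ℕ≥1, so we require
--    that 0 is never in the domain of the guard function (hence of r).
--  * Blue labels [k] are Fin k.
--  * A partial map A ⇀ B is a function A → Maybe B.
--  * Node sets are types with a finite enumeration (a list containing
--    every element); edges are a relation E u v (u blue, v red).

Finite : Set → Set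
Finite A = Σ (List A) λ xs → ∀ a → a ∈ xs

record LIG (k : ℕ) : Set₁ where
  field
    Red   : Set
    Blue  : Set
    Red-finite  : Finite Red
    Blue-finite : Finite Blue
    E     : Blue → Red → Set
    adj   : ∀ v → ∃ λ u → E u v
    r     : ℕ → Maybe Red
    b     : Fin k → Maybe Blue
    g     : ℕ → Maybe (Fin k)
    dom-rg : ∀ i → is-just (r i) ≡ is-just (g i)
    g-finite : Σ ℕ λ N → ∀ i → N ≤ i → g i ≡ nothing
    g-pos : g 0 ≡ nothing

open LIG public

RealGuards : ∀ {k} → LIG k → Set
RealGuards K = ∀ i v → r K i ≡ just v →
  Σ (Fin _) λ j → g K i ≡ just j × (Σ (Blue K) λ u → b K j ≡ just u × E K u v)

restrict : {A : Set} → (ℕ → Bool) → (ℕ → Maybe A) → ℕ → Maybe A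
restrict X h i = if X i then nothing else h i

restrict-nothing : {A : Set} (X : ℕ → Bool) (h : ℕ → Maybe A) (i : ℕ) →
  h i ≡ nothing → restrict X h i ≡ nothing
restrict-nothing X h i eq with X i
... | true  = refl
... | false = eq

restrict-dom : {A B : Set} (X : ℕ → Bool) (h : ℕ → Maybe A) (h' : ℕ → Maybe B)
  (i : ℕ) → is-just (h i) ≡ is-just (h' i) →
  is-just (restrict X h i) ≡ is-just (restrict X h' i)
restrict-dom X h h' i eq with X i
... | true  = refl
... | false = eq

removeRed : ∀ {k} → (ℕ → Bool) → LIG k → LIG k
removeRed X K = record
  { Red = Red K ; Blue = Blue K
  ; Red-finite = Red-finite K ; Blue-finite = Blue-finite K
  ; E = E K ; adj = adj K
  ; r = restrict X (r K) ; b = b K ; g = restrict X (g K)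
  ; dom-rg = λ i → restrict-dom X (r K) (g K) i (dom-rg K i)
  ; g-finite = proj₁ (g-finite K) ,
      (λ i le → restrict-nothing X (g K) i (proj₂ (g-finite K) i le))
  ; g-pos = restrict-nothing X (g K) 0 (g-pos K)
  }

removeBlue : ∀ {k} → (Fin k → Bool) → LIG k → LIG k
removeBlue X K = record
  { Red = Red K ; Blue = Blue K
  ; Red-finite = Red-finite K ; Blue-finite = Blue-finite K
  ; E = E K ; adj = adj K
  ; r = r K ; b = λ j → if X j then nothing else b K j ; g = g K
  ; dom-rg = dom-rg K ; g-finite = g-finite K ; g-pos = g-pos K
  }

Compatible : ∀ {k} → (ℕ → Maybe (Fin k)) → (ℕ → Maybe (Fin k)) → Set
Compatible g₁ g₂ = ∀ i j j' → g₁ i ≡ just j → g₂ i ≡ just j' → j ≡ j'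

IsTransition : ∀ {k} → (g f : ℕ → Maybe (Fin k)) → Set
IsTransition g f =
    (∃ λ i → is-just (f i) ≡ true)
  × (∀ i → is-just (f i) ≡ true → is-just (g i) ≡ true)
  × (∀ i j → g i ≡ just j → (∃ λ i' → f i' ≡ just j) →
       is-just (f i) ≡ true)

-- Glueing K₁ ⊕ K₂, described up to isomorphism: K is the quotient of the
-- disjoint union by the equivalence generated by "same red label" /
-- "same blue label", presented by surjections φR, φB whose kernels are
-- exactly the generated equivalences.

data SameRed {k} (K₁ K₂ : LIG k) : Red K₁ ⊎ Red K₂ → Red K₁ ⊎ Red K₂ → Set where
  same : ∀ {i x y} → r K₁ i ≡ just x → r K₂ i ≡ just y →
         SameRed K₁ K₂ (inj₁ x) (inj₂ y)

data SameBlue {k} (K₁ K₂ : LIG k) : Blue K₁ ⊎ Blue K₂ → Blue K₁ ⊎ Blue K₂ → Set where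
  same : ∀ {j x y} → b K₁ j ≡ just x → b K₂ j ≡ just y →
         SameBlue K₁ K₂ (inj₁ x) (inj₂ y)

EdgeSum : ∀ {k} (K₁ K₂ : LIG k) → Blue K₁ ⊎ Blue K₂ → Red K₁ ⊎ Red K₂ → Set
EdgeSum K₁ K₂ (inj₁ u) (inj₁ v) = E K₁ u v
EdgeSum K₁ K₂ (inj₂ u) (inj₂ v) = E K₂ u v
EdgeSum K₁ K₂ _        _        = Data.Empty.⊥
  where import Data.Empty

record IsGlue {k} (K₁ K₂ K : LIG k) : Set where
  field
    φR : Red K₁ ⊎ Red K₂ → Red K
    φB : Blue K₁ ⊎ Blue K₂ → Blue K
    φR-surj : ∀ v → ∃ λ x → φR x ≡ v
    φB-surj : ∀ u → ∃ λ x → φB x ≡ u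
    φR-ker : ∀ x y → (φR x ≡ φR y) ⇔ EqClosure (SameRed K₁ K₂) x y
    φB-ker : ∀ x y → (φB x ≡ φB y) ⇔ EqClosure (SameBlue K₁ K₂) x y
    edges : ∀ u v → E K u v ⇔
      (∃ λ u' → ∃ λ v' → EdgeSum K₁ K₂ u' v' × φB u' ≡ u × φR v' ≡ v)
    r-glue : ∀ i → r K i ≡
      (Maybe.map (φR ∘ inj₁) (r K₁ i) <∣> Maybe.map (φR ∘ inj₂) (r K₂ i))
    b-glue : ∀ j → b K j ≡
      (Maybe.map (φB ∘ inj₁) (b K₁ j) <∣> Maybe.map (φB ∘ inj₂) (b K₂ j))
    g-glue : ∀ i → g K i ≡ (g K₁ i <∣> g K₂ i)

-- K is (isomorphic to) K_f: red nodes v_i (i ∈ dom f) given by r,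
-- blue nodes e_j (j ∈ im f) given by b, edges (e_{f(i)}, v_i), guard f.

record IsKf {k} (f : ℕ → Maybe (Fin k)) (K : LIG k) : Set where
  field
    g-is-f  : ∀ i → g K i ≡ f i
    r-dom   : ∀ i → is-just (r K i) ≡ is-just (f i)
    r-onto  : ∀ v → ∃ λ i → r K i ≡ just v
    r-inj   : ∀ i i' v → r K i ≡ just v → r K i' ≡ just v → i ≡ i'
    b-dom   : ∀ j → (is-just (b K j) ≡ true) ⇔ (∃ λ i → f i ≡ just j)
    b-onto  : ∀ u → ∃ λ j → b K j ≡ just u
    b-inj   : ∀ j j' u → b K j ≡ just u → b K j' ≡ just u → j ≡ j'
    edges   : ∀ u v → E K u v ⇔
      (∃ λ i → ∃ λ j → f i ≡ just j × b K j ≡ just u × r K i ≡ just v)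

data GLI (k : ℕ) : LIG k → Set₁ where
  base : (K : LIG k) →
         (∀ v → ∃ λ i → r K i ≡ just v) →
         (∀ u → ∃ λ j → b K j ≡ just u) →
         RealGuards K →
         GLI k K
  remRed : ∀ {K} (X : ℕ → Bool) →
         (∀ i → X i ≡ true → is-just (r K i) ≡ true) →
         GLI k K → GLI k (removeRed X K)
  remBlue : ∀ {K} (X : Fin k → Bool) →
         (∀ j → X j ≡ true →
            is-just (b K j) ≡ true × (∀ i → g K i ≢ just j)) →
         GLI k K → GLI k (removeBlue X K)
  transition : ∀ {K Kf K'} (f : ℕ → Maybe (Fin k)) →
         IsTransition (g K) f →
         (X : Fin k → Bool) →
         (∀ j → (X j ≡ true) ⇔
            ((∃ λ i → g K i ≡ just j) × (∃ λ i → f i ≡ just j)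
              × is-just (b K j) ≡ true)) →
         IsKf f Kf →
         IsGlue Kf (removeBlue X K) K' →
         GLI k K → GLI k K'
  glue : ∀ {K₁ K₂ K} → GLI k K₁ → GLI k K₂ →
         Compatible (g K₁) (g K₂) →
         IsGlue K₁ K₂ K →
         GLI k K

-- Removing red labels or blue labels outside
-- im g cannot break a guard, and K_f has real guards by construction. In a glueing, a red
-- label of K₁ keeps its guard edge from K₁; a red label i only of K₂ has g₁ i undefined,
-- so its guard j comes from K₂, and if j also names a blue node of K₁ that node is
-- identified with the one of K₂. A transition K[f] is such a glueing, and the blue labels
-- it removes from K lie in im f, which by the closure condition on f never contains the
-- guard of a red label outside dom f.
module Submission where

open import Defs
open import Data.Nat using (ℕ; _≤_)
open import Data.Fin using (Fin)
open import Data.Bool using (Bool; true; false)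
open import Data.Bool.Properties using (¬-not)
open import Data.Maybe using (Maybe; just; nothing; is-just; _<∣>_)
import Data.Maybe as Maybe
open import Data.Maybe.Properties using (map-just)
open import Data.Product using (Σ; ∃; _×_; _,_; proj₁; proj₂)
open import Data.Sum using (_⊎_; inj₁; inj₂)
open import Data.Empty using (⊥)
open import Function.Bundles using (Equivalence)
open import Relation.Binary.PropositionalEquality
  using (_≡_; _≢_; refl; sym; trans; cong)
open import Relation.Binary.Construct.Closure.ReflexiveTransitive using (ε; _◅_)
open import Relation.Binary.Construct.Closure.Symmetric using (fwd)

open Equivalence using (to; from)

private
  variable
    A B C : Set
    k : ℕ

just⇒is-just : {a : Maybe A} {x : A} → a ≡ just x → is-just a ≡ true
just⇒is-just refl = refl

is-just⇒just : (a : Maybe A) → is-just a ≡ true → ∃ λ x → a ≡ just x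
is-just⇒just (just x) _ = x , refl

nothing⇒¬is-just : {a : Maybe A} → a ≡ nothing → is-just a ≢ true
nothing⇒¬is-just refl ()

is-just-nothing : {a : Maybe A} {c : Maybe B} → is-just a ≡ is-just c → a ≡ nothing → c ≡ nothing
is-just-nothing {a = nothing} {c = nothing} _ refl = refl

<∣>-justˡ : {a : Maybe A} (c : Maybe A) {x : A} → a ≡ just x → (a <∣> c) ≡ just x
<∣>-justˡ c refl = refl

<∣>-nothingˡ : {a : Maybe A} (c : Maybe A) → a ≡ nothing → (a <∣> c) ≡ c
<∣>-nothingˡ c refl = refl

<∣>-map-just⁻ : (f : A → C) (h : B → C) (a : Maybe A) (c : Maybe B) {v : C} →
  (Maybe.map f a <∣> Maybe.map h c) ≡ just v →
  (∃ λ x → a ≡ just x × f x ≡ v) ⊎ (a ≡ nothing × ∃ λ y → c ≡ just y × h y ≡ v)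
<∣>-map-just⁻ f h (just x) c refl = inj₁ (x , refl , refl)
<∣>-map-just⁻ f h nothing (just y) refl = inj₂ (refl , y , refl , refl)

GuardRealAt : LIG k → ℕ → Set
GuardRealAt K i = ∀ v → r K i ≡ just v →
  Σ (Fin _) λ j → g K i ≡ just j × (Σ (Blue K) λ u → b K j ≡ just u × E K u v)

removeRed-realGuards : ∀ {K : LIG k} (X : ℕ → Bool) → RealGuards K → RealGuards (removeRed X K)
removeRed-realGuards X real i v ri with X i
... | false = real i v ri

removeBlue-guardRealAt : ∀ {K : LIG k} (X : Fin k → Bool) {i : ℕ} →
  (∀ j → g K i ≡ just j → X j ≢ true) →
  GuardRealAt K i → GuardRealAt (removeBlue X K) i
removeBlue-guardRealAt {K = K} X guard-kept real v ri with real v ri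
... | j , gi , u , bj , e = j , gi , u , b-kept , e
  where
  b-kept : b (removeBlue X K) j ≡ just u
  b-kept rewrite ¬-not (guard-kept j gi) = bj

Kf-realGuards : ∀ {f : ℕ → Maybe (Fin k)} {K : LIG k} → IsKf f K → RealGuards K
Kf-realGuards {f = f} {K} Kf i v ri
  with is-just⇒just (f i) (trans (sym (IsKf.r-dom Kf i)) (just⇒is-just ri))
... | j , fi with is-just⇒just (b K j) (from (IsKf.b-dom Kf j) (i , fi))
... | u , bj =
  j , trans (IsKf.g-is-f Kf i) fi , u , bj , from (IsKf.edges Kf u v) (i , j , fi , bj , ri)

module _ {K₁ K₂ K : LIG k} (G : IsGlue K₁ K₂ K) where
  open IsGlue G

  glue-red⁻ : ∀ {i v} → r K i ≡ just v →
    (∃ λ x → r K₁ i ≡ just x × φR (inj₁ x) ≡ v) ⊎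
    (r K₁ i ≡ nothing × ∃ λ y → r K₂ i ≡ just y × φR (inj₂ y) ≡ v)
  glue-red⁻ {i} ri = <∣>-map-just⁻ _ _ (r K₁ i) (r K₂ i) (trans (sym (r-glue i)) ri)

  glue-blueˡ : ∀ {j u} → b K₁ j ≡ just u → b K j ≡ just (φB (inj₁ u))
  glue-blueˡ {j} bj = trans (b-glue j) (<∣>-justˡ _ (map-just bj))

  -- A blue label of both summands names a single node: the two copies are identified.
  glue-blueʳ : ∀ {j u} → b K₂ j ≡ just u → b K j ≡ just (φB (inj₂ u))
  glue-blueʳ {j} bj with b K₁ j in b₁j
  ... | just _  = trans (glue-blueˡ b₁j) (cong just (from (φB-ker _ _) (fwd (same b₁j bj) ◅ ε)))
  ... | nothing =
    trans (b-glue j) (trans (<∣>-nothingˡ _ (cong (Maybe.map _) b₁j)) (map-just bj))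

  glue-edgeˡ : ∀ {u v} → E K₁ u v → E K (φB (inj₁ u)) (φR (inj₁ v))
  glue-edgeˡ {u} {v} e = from (edges _ _) (inj₁ u , inj₁ v , e , refl , refl)

  glue-edgeʳ : ∀ {u v} → E K₂ u v → E K (φB (inj₂ u)) (φR (inj₂ v))
  glue-edgeʳ {u} {v} e = from (edges _ _) (inj₂ u , inj₂ v , e , refl , refl)

  glue-guardRealAt : ∀ {i} → GuardRealAt K₁ i → (r K₁ i ≡ nothing → GuardRealAt K₂ i) →
    GuardRealAt K i
  glue-guardRealAt {i} real₁ real₂ v ri with glue-red⁻ ri
  ... | inj₁ (x , r₁i , refl) with real₁ x r₁i
  ...   | j , g₁i , _ , b₁j , e =
          j , trans (g-glue i) (<∣>-justˡ _ g₁i) , _ , glue-blueˡ b₁j , glue-edgeˡ e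
  glue-guardRealAt {i} real₁ real₂ v ri | inj₂ (r₁i , y , r₂i , refl) with real₂ r₁i y r₂i
  ...   | j , g₂i , _ , b₂j , e =
          j , trans (g-glue i) (trans (<∣>-nothingˡ _ g₁i) g₂i) , _ , glue-blueʳ b₂j , glue-edgeʳ e
    where
    g₁i : g K₁ i ≡ nothing
    g₁i = is-just-nothing (dom-rg K₁ i) r₁i

  glue-realGuards : RealGuards K₁ → RealGuards K₂ → RealGuards K
  glue-realGuards real₁ real₂ i = glue-guardRealAt (real₁ i) (λ _ → real₂ i)

guard∉im-transition : ∀ {g f : ℕ → Maybe (Fin k)} → IsTransition g f →
  ∀ {i j} → f i ≡ nothing → g i ≡ just j → (∃ λ i′ → f i′ ≡ just j) → ⊥
guard∉im-transition (_ , _ , closed) fi gi j∈imf = nothing⇒¬is-just fi (closed _ _ gi j∈imf)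

transition-realGuards : ∀ {K Kf K′ : LIG k} {f : ℕ → Maybe (Fin k)} {X : Fin k → Bool} →
  IsTransition (g K) f → (∀ j → X j ≡ true → ∃ λ i → f i ≡ just j) →
  IsKf f Kf → IsGlue Kf (removeBlue X K) K′ → RealGuards K → RealGuards K′
transition-realGuards {K = K} {X = X} trans-f X⊆imf Kf G real i =
  glue-guardRealAt G (Kf-realGuards Kf i) λ rᶠi →
    removeBlue-guardRealAt {K = K} X
      (λ j gi Xj →
        guard∉im-transition trans-f (is-just-nothing (IsKf.r-dom Kf i) rᶠi) gi (X⊆imf j Xj))
      (real i)

lemma4 : (k : ℕ) → 1 ≤ k → (K : LIG k) → GLI k K → RealGuards K
lemma4 k _ K (base .K _ _ real) = real
lemma4 k k≥1 _ (remRed {K} X _ d) =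
  removeRed-realGuards {K = K} X (lemma4 k k≥1 K d)
lemma4 k k≥1 _ (remBlue {K} X X⊆dom∖im d) i =
  removeBlue-guardRealAt {K = K} X (λ j gi Xj → X⊆dom∖im j Xj .proj₂ i gi)
    (lemma4 k k≥1 K d i)
lemma4 k k≥1 _ (transition {K} f trans-f X X-def Kf G d) =
  transition-realGuards trans-f (λ j Xj → to (X-def j) Xj .proj₂ .proj₁) Kf G
    (lemma4 k k≥1 K d)
lemma4 k k≥1 _ (glue {K₁} {K₂} d₁ d₂ _ G) =
  glue-realGuards G (lemma4 k k≥1 K₁ d₁) (lemma4 k k≥1 K₂ d₂)
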